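{- Let $n\ge0$, $k\ge1$ and $r\in\{1,\dots,k\}$. If $\mathrm{MP}(n,k,r)$ is nonempty, then $r=1$ or $n=mk$ for some integer $m$.
   Context: $\mathrm{MP}(n,k,r)$ is the set of permutations $\pi$ of $[n]$ with $\pi(i)\equiv r+i-1\pmod k$ for all $1\le i\le n$. -}

module Defs where

open import Data.Nat using (ℕ; suc; _+_; NonZero)
open import Data.Nat.DivMod using (_%_)
open import Data.Fin using (Fin; toℕ)
open import Data.Fin.Permutation using (Permutation′; _⟨$⟩ʳ_)
open import Relation.Binary.PropositionalEquality using (_≡_)

-- Elements of [n] = {1,…,n} are represented by Fin n, with i : Fin n
-- standing for toℕ i + 1.  A permutation of [n] is a Permutation′ n
-- (bijection Fin n ↔ Fin n).
-- π ∈ MP(n,k,r)  iff  for all i, π(i) ≡ r + i - 1 (mod k), i.e. in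
-- 0-based terms: (toℕ (π i) + 1) ≡ r + toℕ i  (mod k).
IsMP : (n k r : ℕ) .{{_ : NonZero k}} → Permutation′ n → Set
IsMP n k r π = ∀ (i : Fin n) → (suc (toℕ (π ⟨$⟩ʳ i))) % k ≡ (r + toℕ i) % k

{-# OPTIONS --safe #-}
module Submission where

open import Defs
open import Data.Nat using (ℕ; zero; suc; _+_; _∸_; _*_; _≤_; _<_; NonZero; s≤s; z≤n; _<?_)
open import Data.Nat.Properties
open import Data.Nat.DivMod
open import Data.Fin using (Fin; toℕ; fromℕ<)
open import Data.Fin.Properties using (toℕ-fromℕ<; toℕ-injective; toℕ<n; injective⇒≤)
open import Data.Fin.Permutation using (Permutation′; _⟨$⟩ʳ_; _⟨$⟩ˡ_; inverseˡ)
open import Data.Product using (Σ; ∃; _×_; _,_)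
open import Data.Sum using (_⊎_; inj₁; inj₂)
open import Data.Empty using (⊥)
open import Function.Definitions using (Injective)
open import Relation.Nullary using (yes; no; contradiction)
open import Relation.Binary.PropositionalEquality

-- Write n = q k + t with 0 < t < k.  In [0, n) the residue classes below t have
-- q + 1 elements and the others q.  A permutation in MP(n,k,1+s) maps the class
-- of a into the class of s + a, so it suffices to find a class a < t whose
-- shift s + a is one of the short classes; for 0 < s < k such an a exists.

suc-%-cancel : ∀ x y k .{{_ : NonZero k}} → suc x % k ≡ suc y % k → x % k ≡ y % k
suc-%-cancel x y k@(suc k′) h = begin
  x % k                     ≡⟨ [m+n]%n≡m%n x k ⟨
  (x + k) % k               ≡⟨ cong (_% k) (+-suc x k′) ⟩
  (suc x + k′) % k          ≡⟨ %-distribˡ-+ (suc x) k′ k ⟩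
  (suc x % k + k′ % k) % k  ≡⟨ cong (λ z → (z + k′ % k) % k) h ⟩
  (suc y % k + k′ % k) % k  ≡⟨ %-distribˡ-+ (suc y) k′ k ⟨
  (suc y + k′) % k          ≡⟨ cong (_% k) (+-suc y k′) ⟨
  (y + k) % k               ≡⟨ [m+n]%n≡m%n y k ⟩
  y % k                     ∎
  where open ≡-Reasoning

+-%-congʳ : ∀ m {x y} k .{{_ : NonZero k}} → x % k ≡ y % k → (m + x) % k ≡ (m + y) % k
+-%-congʳ m {x} {y} k x≡y = begin
  (m + x) % k            ≡⟨ %-distribˡ-+ m x k ⟩
  (m % k + x % k) % k    ≡⟨ cong (λ z → (m % k + z) % k) x≡y ⟩
  (m % k + y % k) % k    ≡⟨ %-distribˡ-+ m y k ⟨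
  (m + y) % k            ∎
  where open ≡-Reasoning

%-/-injective : ∀ {x y} k .{{_ : NonZero k}} → x % k ≡ y % k → x / k ≡ y / k → x ≡ y
%-/-injective {x} {y} k %-eq /-eq = begin
  x                  ≡⟨ m≡m%n+[m/n]*n x k ⟩
  x % k + x / k * k  ≡⟨ cong₂ (λ u v → u + v * k) %-eq /-eq ⟩
  y % k + y / k * k  ≡⟨ m≡m%n+[m/n]*n y k ⟨
  y                  ∎
  where open ≡-Reasoning

/-<-of-short-class : ∀ {x n} k .{{_ : NonZero k}} → x < n → n % k ≤ x % k → x / k < n / k
/-<-of-short-class {x} {n} k x<n n%k≤x%k with x / k <? n / k
... | yes x/k<n/k = x/k<n/k
... | no x/k≮n/k = contradiction n≤x (<⇒≱ x<n)
  where
  n≤x : n ≤ x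
  n≤x = subst₂ _≤_ (sym (m≡m%n+[m/n]*n n k)) (sym (m≡m%n+[m/n]*n x k))
          (+-mono-≤ n%k≤x%k (*-monoˡ-≤ k (≮⇒≥ x/k≮n/k)))

no-long-class-into-short-class :
  ∀ {n k a b} .{{_ : NonZero k}} (π : Permutation′ n) → a < n % k → n % k ≤ b →
  (∀ i → toℕ i % k ≡ a → toℕ (π ⟨$⟩ʳ i) % k ≡ b) → ⊥
no-long-class-into-short-class {n} {k} {a} {b} π a<t t≤b maps =
  <-irrefl refl (injective⇒≤ image-quotient-injective)
  where
  q = n / k

  member<n : ∀ j → j ≤ q → a + j * k < n
  member<n j j≤q = subst (a + j * k <_) (sym (m≡m%n+[m/n]*n n k))
                     (+-mono-<-≤ a<t (*-monoˡ-≤ k j≤q))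

  member : Fin (suc q) → Fin n
  member j = fromℕ< (member<n (toℕ j) (<⇒≤pred (toℕ<n j)))

  member-% : ∀ j → toℕ (member j) % k ≡ a
  member-% j = begin
    toℕ (member j) % k      ≡⟨ cong (_% k) (toℕ-fromℕ< _) ⟩
    (a + toℕ j * k) % k     ≡⟨ [m+kn]%n≡m%n a (toℕ j) k ⟩
    a % k                   ≡⟨ m<n⇒m%n≡m (<-≤-trans a<t (m%n≤n n k)) ⟩
    a                       ∎
    where open ≡-Reasoning

  image : Fin (suc q) → ℕ
  image j = toℕ (π ⟨$⟩ʳ member j)

  image-% : ∀ j → image j % k ≡ b
  image-% j = maps (member j) (member-% j)

  image-quotient : Fin (suc q) → Fin q
  image-quotient j = fromℕ< (/-<-of-short-class k (toℕ<n (π ⟨$⟩ʳ member j))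
                  (subst (n % k ≤_) (sym (image-% j)) t≤b))

  image-quotient-injective : Injective _≡_ _≡_ image-quotient
  image-quotient-injective {i} {j} quotients-equal = toℕ-injective (*-cancelʳ-≡ (toℕ i) (toℕ j) k
                                (+-cancelˡ-≡ a _ _ members-equal))
    where
    images-equal : image i ≡ image j
    images-equal = %-/-injective k (trans (image-% i) (sym (image-% j)))
                     (trans (sym (toℕ-fromℕ< _)) (trans (cong toℕ quotients-equal) (toℕ-fromℕ< _)))

    members-equal : a + toℕ i * k ≡ a + toℕ j * k
    members-equal = begin
      a + toℕ i * k                                   ≡⟨ toℕ-fromℕ< _ ⟨
      toℕ (member i)                                  ≡⟨ cong toℕ (inverseˡ π) ⟨
      toℕ (π ⟨$⟩ˡ (π ⟨$⟩ʳ member i))                  ≡⟨ cong (λ x → toℕ (π ⟨$⟩ˡ x)) (toℕ-injective images-equal) ⟩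
      toℕ (π ⟨$⟩ˡ (π ⟨$⟩ʳ member j))                  ≡⟨ cong toℕ (inverseˡ π) ⟩
      toℕ (member j)                                  ≡⟨ toℕ-fromℕ< _ ⟩
      a + toℕ j * k                                   ∎
      where open ≡-Reasoning

long-class-with-short-shift : ∀ {k s t} .{{_ : NonZero k}} → 1 ≤ s → s < k → 0 < t → t < k →
  ∃ λ a → a < t × t ≤ (s + a) % k
long-class-with-short-shift {k} {s} {suc t′} 1≤s s<k _ t<k with s + t′ <? k
... | yes s+t′<k = t′ , n<1+n t′ ,
        subst (suc t′ ≤_) (sym (m<n⇒m%n≡m s+t′<k)) (+-monoˡ-≤ t′ 1≤s)
... | no s+t′≮k = a , a<t , subst (suc t′ ≤_) (sym (m<n⇒m%n≡m s+a<k)) t≤s+a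
  where
  a = k ∸ suc s
  1+s+a≡k : suc (s + a) ≡ k
  1+s+a≡k = m+[n∸m]≡n s<k
  s+a<k : s + a < k
  s+a<k = ≤-reflexive 1+s+a≡k
  t≤s+a : suc t′ ≤ s + a
  t≤s+a = ≤-pred (subst (suc t′ <_) (sym 1+s+a≡k) t<k)
  a<t : a < suc t′
  a<t = m≤n⇒m≤1+n (+-cancelˡ-≤ s (suc a) t′
          (subst (_≤ s + t′) (trans (sym 1+s+a≡k) (sym (+-suc s a))) (≮⇒≥ s+t′≮k)))

IsMP-shifts-residue-class : ∀ {n k s a} .{{_ : NonZero k}} (π : Permutation′ n) →
  IsMP n k (suc s) π → ∀ i → toℕ i % k ≡ a → toℕ (π ⟨$⟩ʳ i) % k ≡ (s + a) % k
IsMP-shifts-residue-class {k = k} {s} {a} π mp i i%k≡a = begin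
  toℕ (π ⟨$⟩ʳ i) % k    ≡⟨ suc-%-cancel _ (s + toℕ i) k (mp i) ⟩
  (s + toℕ i) % k       ≡⟨ +-%-congʳ s k (sym (m%n%n≡m%n (toℕ i) k)) ⟩
  (s + toℕ i % k) % k   ≡⟨ cong (λ x → (s + x) % k) i%k≡a ⟩
  (s + a) % k           ∎
  where open ≡-Reasoning

mainTheorem17 : (n k r : ℕ) .{{_ : NonZero k}} → 1 ≤ r → r ≤ k →
    Σ (Permutation′ n) (IsMP n k r) → r ≡ 1 ⊎ ∃ (λ m → n ≡ m * k)
mainTheorem17 n k (suc zero) _ _ _ = inj₁ refl
mainTheorem17 n k (suc s@(suc _)) _ r≤k (π , mp) with n % k in n%k≡t
... | zero = inj₂ (n / k , trans (m≡m%n+[m/n]*n n k) (cong (_+ n / k * k) n%k≡t))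
... | suc _ with long-class-with-short-shift (s≤s z≤n) r≤k (s≤s z≤n)
                   (subst (_< k) n%k≡t (m%n<n n k))
...   | a , a<t , t≤s+a = contradiction (IsMP-shifts-residue-class π mp)
          (no-long-class-into-short-class π (subst (a <_) (sym n%k≡t) a<t)
                                            (subst (_≤ (s + a) % k) (sym n%k≡t) t≤s+a))
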